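{- Let $\Delta=\Delta(X,Y,T,E)$ be a tableau complex, let $\mathbb{k}$ be a field and $S=\mathbb{k}[V]$ with $V=\{v_{(x,y)}:(x,y)\in E\}$. Then \[K(S/I_\Delta;\mathbf t)=\sum_F\prod_{x\in X}\Bigg(\prod_{y\in E(x)\setminus F(x)}t_{v_{(x,y)}}\prod_{y\in F(x)}\big(1-t_{v_{(x,y)}}\big)\Bigg),\] the sum over all set-valued tableaux $F\subseteq E$ that contain some tableau $f\in T$.
   Context: Let $X,Y$ be finite sets; a tableau is a function $f:X\to Y$ identified with its graph in $X\times Y$; a set-valued tableau is $F\subseteq X\times Y$ with $F(x)=\{y:(x,y)\in F\}$. Let $T$ be a set of tableaux and $E\subseteq X\times Y$ contain every $f\in T$; put $v_{(x,y)}:=E\setminus\{(x,y)\}$. The tableau complex $\Delta(X,Y,T,E)$ is the simplicial complex on ground set $V$ whose faces are the sets $\{v_{(x,y)}:(x,y)\in E\setminus F\}$ for $F\subseteq E$ containing some $f\in T$. The Stanley–Reisner ideal $I_\Delta\subseteq S$ is generated by the monomials $\prod_{v\in G}v$ for $G\subseteq V$ not a face. Grading $S$ by $\mathbb Z^V$ (variable $v$ has degree $t_v$), the $K$-polynomial $K(S/I_\Delta;\mathbf t)$ is the polynomial with Hilbert series of $S/I_\Delta$ equal to $K(S/I_\Delta;\mathbf t)/\prod_{v\in V}(1-t_v)$. -}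

module Defs where

open import Data.Bool using (Bool; true; false; _∧_; _∨_; not; if_then_else_)
open import Data.Nat as ℕ using (ℕ; zero; suc; _∸_)
open import Data.Integer as ℤ using (ℤ; +_; -_)
open import Data.Fin as Fin using (Fin; zero; suc)
open import Data.List using (List; []; _∷_; _++_; map; concatMap; allFin; foldr; filterᵇ)
open import Data.Bool.ListAction using (all; any)
open import Data.Product using (_×_; _,_)
open import Relation.Nullary.Decidable using (⌊_⌋)

-- A tableau f : X → Y (identified with its graph).
Tableau : ℕ → ℕ → Set
Tableau nX nY = Fin nX → Fin nY

-- A subset of X × Y (decidable membership); a set-valued tableau F
-- with F(x) = { y | F x y ≡ true }.
SetTab : ℕ → ℕ → Set
SetTab nX nY = Fin nX → Fin nY → Bool

allB : ∀ {n} → (Fin n → Bool) → Bool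
allB {n} p = all p (allFin n)

anyB : ∀ {n} → (Fin n → Bool) → Bool
anyB {n} p = any p (allFin n)

_⊆ᵇ_ : ∀ {nX nY} → SetTab nX nY → SetTab nX nY → Bool
F ⊆ᵇ G = allB λ x → allB λ y → not (F x y) ∨ G x y

_≐ᵇ_ : ∀ {nX nY} → SetTab nX nY → SetTab nX nY → Bool
F ≐ᵇ G = (F ⊆ᵇ G) ∧ (G ⊆ᵇ F)

_∖_ : ∀ {nX nY} → SetTab nX nY → SetTab nX nY → SetTab nX nY
(E ∖ F) x y = E x y ∧ not (F x y)

graph : ∀ {nX nY} → Tableau nX nY → SetTab nX nY
graph f x y = ⌊ f x Fin.≟ y ⌋

containsSome : ∀ {nX nY} → List (Tableau nX nY) → SetTab nX nY → Bool
containsSome T F = any (λ f → graph f ⊆ᵇ F) T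

allFuns : ∀ n {A : Set} → List A → List (Fin n → A)
allFuns zero xs = (λ ()) ∷ []
allFuns (suc n) xs =
  concatMap (λ a → map (λ f → λ { zero → a ; (suc i) → f i }) (allFuns n xs)) xs

-- enumeration of all subsets of X × Y (each exactly once)
allSetTabs : ∀ nX nY → List (SetTab nX nY)
allSetTabs nX nY = allFuns nX (allFuns nY (true ∷ false ∷ []))

admissible : ∀ {nX nY} → List (Tableau nX nY) → SetTab nX nY → SetTab nX nY → Bool
admissible T E F = (F ⊆ᵇ E) ∧ containsSome T F

-- The ground set V = { v_(x,y) | (x,y) ∈ E } is in bijection with E via
-- (x,y) ↦ v_(x,y) = E ∖ {(x,y)} (injective), so a subset G ⊆ V is
-- represented by the subset { (x,y) ∈ E | v_(x,y) ∈ G } of E.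
-- G is a face iff G = { v_(x,y) | (x,y) ∈ E ∖ F } for some F ⊆ E
-- containing some f ∈ T.
isFace : ∀ {nX nY} → List (Tableau nX nY) → SetTab nX nY → SetTab nX nY → Bool
isFace {nX} {nY} T E G =
  any (λ F → admissible T E F ∧ (G ≐ᵇ (E ∖ F))) (allSetTabs nX nY)

-- Monomials / exponent vectors.  Variables t_(x,y) are indexed by X × Y;
-- the monomials of S = k[V] are those supported on E.
Exp : ℕ → ℕ → Set
Exp nX nY = Fin nX → Fin nY → ℕ

supp : ∀ {nX nY} → Exp nX nY → SetTab nX nY
supp a x y = not ⌊ a x y ℕ.≟ 0 ⌋

isMonomialOfS : ∀ {nX nY} → SetTab nX nY → Exp nX nY → Bool
isMonomialOfS E a = supp a ⊆ᵇ E

-- The Stanley–Reisner ideal I_Δ is generated by the monomials ∏_{v∈G} v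
-- for G ⊆ V a non-face; a monomial x^a lies in this monomial ideal iff it
-- is divisible by one of the generators, i.e. G ⊆ supp a for some non-face G.
inSR : ∀ {nX nY} → List (Tableau nX nY) → SetTab nX nY → Exp nX nY → Bool
inSR {nX} {nY} T E a =
  any (λ G → (G ⊆ᵇ E) ∧ not (isFace T E G) ∧ (G ⊆ᵇ supp a)) (allSetTabs nX nY)

-- Multigraded Hilbert series of S/I_Δ, as its coefficient function:
-- coefficient of t^a is dim_k (S/I_Δ)_a, which for a monomial ideal is
-- 1 if x^a is a monomial of S not in I_Δ, and 0 otherwise.
hilbertSR : ∀ {nX nY} → List (Tableau nX nY) → SetTab nX nY → Exp nX nY → ℤ
hilbertSR T E a =
  if isMonomialOfS E a ∧ not (inSR T E a) then + 1 else + 0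

Poly : ℕ → ℕ → Set
Poly nX nY = List (ℤ × Exp nX nY)

zeroExp : ∀ {nX nY} → Exp nX nY
zeroExp x y = 0

unitExp : ∀ {nX nY} → Fin nX → Fin nY → Exp nX nY
unitExp x₀ y₀ x y = if ⌊ x Fin.≟ x₀ ⌋ ∧ ⌊ y Fin.≟ y₀ ⌋ then 1 else 0

_+ₑ_ : ∀ {nX nY} → Exp nX nY → Exp nX nY → Exp nX nY
(a +ₑ b) x y = a x y ℕ.+ b x y

_∸ₑ_ : ∀ {nX nY} → Exp nX nY → Exp nX nY → Exp nX nY
(a ∸ₑ b) x y = a x y ∸ b x y

_≡ₑ_ : ∀ {nX nY} → Exp nX nY → Exp nX nY → Bool
a ≡ₑ b = allB λ x → allB λ y → ⌊ a x y ℕ.≟ b x y ⌋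

_≤ₑ_ : ∀ {nX nY} → Exp nX nY → Exp nX nY → Bool
a ≤ₑ b = allB λ x → allB λ y → ⌊ a x y ℕ.≤? b x y ⌋

oneP : ∀ {nX nY} → Poly nX nY
oneP = (+ 1 , zeroExp) ∷ []

varP : ∀ {nX nY} → Fin nX → Fin nY → Poly nX nY
varP x y = (+ 1 , unitExp x y) ∷ []

oneMinusVarP : ∀ {nX nY} → Fin nX → Fin nY → Poly nX nY
oneMinusVarP x y = (+ 1 , zeroExp) ∷ (- (+ 1) , unitExp x y) ∷ []

_*P_ : ∀ {nX nY} → Poly nX nY → Poly nX nY → Poly nX nY
p *P q = concatMap (λ { (c , a) → map (λ { (d , b) → (c ℤ.* d , a +ₑ b) }) q }) p

sumP : ∀ {nX nY} → List (Poly nX nY) → Poly nX nY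
sumP = foldr _++_ []

allPairs : ∀ nX nY → List (Fin nX × Fin nY)
allPairs nX nY = concatMap (λ x → map (λ y → (x , y)) (allFin nY)) (allFin nX)

prodPairs : ∀ {nX nY} → (Fin nX → Fin nY → Poly nX nY) → Poly nX nY
prodPairs {nX} {nY} P = foldr (λ { (x , y) acc → P x y *P acc }) oneP (allPairs nX nY)

coeff : ∀ {nX nY} → Poly nX nY → Exp nX nY → ℤ
coeff p a = foldr (λ { (c , b) acc → (if b ≡ₑ a then c else + 0) ℤ.+ acc }) (+ 0) p

-- coefficient of t^a in the product of a formal power series H (given by
-- its coefficient function) with a polynomial p
_⊛_ : ∀ {nX nY} → (Exp nX nY → ℤ) → Poly nX nY → Exp nX nY → ℤ
(H ⊛ p) a = foldr (λ { (c , b) acc → (if b ≤ₑ a then c ℤ.* H (a ∸ₑ b) else + 0) ℤ.+ acc }) (+ 0) p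

denomE : ∀ {nX nY} → SetTab nX nY → Poly nX nY
denomE E = prodPairs λ x y → if E x y then oneMinusVarP x y else oneP

tableauTerm : ∀ {nX nY} → SetTab nX nY → SetTab nX nY → Poly nX nY
tableauTerm E F = prodPairs λ x y →
  if (E ∖ F) x y then varP x y
  else (if F x y then oneMinusVarP x y else oneP)

kFormula : ∀ {nX nY} → List (Tableau nX nY) → SetTab nX nY → Poly nX nY
kFormula {nX} {nY} T E =
  sumP (map (tableauTerm E) (filterᵇ (admissible T E) (allSetTabs nX nY)))

{-# OPTIONS --safe #-}
module Submission where

-- A monomial t^a survives in S/I_Δ exactly when supp a is a face, i.e. when supp a = E ∖ F
-- for an admissible F, and that F is unique since complementation in E is an involution.
-- So the coefficient of t^a in the Hilbert series is ∑_F [supp a = E ∖ F], and for each F this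
-- indicator is the product series ∏_{(x,y) ∈ E∖F} t/(1 − t) · ∏_{(x,y) ∉ E∖F} 1, with one
-- univariate factor per variable. Multiplying by ∏_{(x,y) ∈ E} (1 − t) acts factor by factor,
-- because each factor of the denominator involves a single variable: t/(1 − t) becomes t on E ∖ F,
-- 1 becomes 1 − t on F, and everything else stays 1.

open import Defs
open import Data.Bool using (Bool; true; false; T; _∧_; _∨_; not; if_then_else_)
import Data.Bool.Properties as Bool
open import Data.Bool.ListAction using (and; all; any)
open import Data.Empty using (⊥-elim)
open import Data.Fin as Fin using (Fin; zero; suc)
open import Data.Fin.Properties using (suc-injective)
open import Data.Integer as ℤ using (ℤ; +_; -_; _+_; _*_)
import Data.Integer.Properties as ℤ
open import Data.Integer.Tactic.RingSolver using (solve-∀)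
open import Data.List using (List; []; _∷_; _++_; map; concatMap; allFin; foldr; filterᵇ; cartesianProduct)
import Data.List.Properties as List
open import Data.List.Membership.Propositional using (_∈_; _∉_)
open import Data.List.Membership.Propositional.Properties using (∈-allFin; ∈-cartesianProduct⁺; ∈-filter⁻)
import Data.List.Relation.Unary.All as All
open import Data.List.Relation.Unary.All.Properties using (all⁺; all⁻)
open import Data.List.Relation.Unary.Any as Any using (Any; here; there; satisfied)
open import Data.List.Relation.Unary.Any.Properties using (any⇔)
open import Data.List.Relation.Unary.Unique.Propositional using (Unique; []; _∷_)
import Data.List.Relation.Unary.Unique.Propositional.Properties as Unique
open import Data.Nat as ℕ using (ℕ; zero; suc; _∸_)
import Data.Nat.Properties as ℕ
open import Data.Product using (_×_; _,_; ∃; proj₁; proj₂)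
open import Data.Product.Properties using (≡-dec)
open import Data.Unit using (tt)
open import Function using (_∘_; _⇔_; mk⇔; Equivalence)
open import Relation.Binary.PropositionalEquality
open import Relation.Nullary using (¬_)
open import Relation.Nullary.Decidable
  using (Dec; T?; ⌊_⌋; yes; no; isYes≗does; does-⇔; toWitness; fromWitness)

open Equivalence using (to; from)
open ≡-Reasoning

private
  variable
    A B : Set
    nX nY : ℕ

-- Finite sums and products

∑ : List A → (A → ℤ) → ℤ
∑ xs g = foldr (λ x s → g x + s) (+ 0) xs

∑-cong : ∀ (xs : List A) {g h : A → ℤ} → (∀ x → x ∈ xs → g x ≡ h x) → ∑ xs g ≡ ∑ xs h
∑-cong []       g≡h = refl
∑-cong (x ∷ xs) g≡h = cong₂ _+_ (g≡h x (here refl)) (∑-cong xs (λ y → g≡h y ∘ there))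

∑-++ : ∀ (xs ys : List A) (g : A → ℤ) → ∑ (xs ++ ys) g ≡ ∑ xs g + ∑ ys g
∑-++ []       ys g = sym (ℤ.+-identityˡ _)
∑-++ (x ∷ xs) ys g = trans (cong (_+_ (g x)) (∑-++ xs ys g)) (sym (ℤ.+-assoc (g x) _ _))

∑-map : (f : A → B) (xs : List A) (g : B → ℤ) → ∑ (map f xs) g ≡ ∑ xs (g ∘ f)
∑-map f []       g = refl
∑-map f (x ∷ xs) g = cong (_+_ (g (f x))) (∑-map f xs g)

∑-concatMap : (f : A → List B) (xs : List A) (g : B → ℤ) →
              ∑ (concatMap f xs) g ≡ ∑ xs (λ x → ∑ (f x) g)
∑-concatMap f []       g = refl
∑-concatMap f (x ∷ xs) g = trans (∑-++ (f x) _ g) (cong (_+_ (∑ (f x) g)) (∑-concatMap f xs g))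

∑-*ˡ : ∀ (xs : List A) (c : ℤ) (g : A → ℤ) → ∑ xs (λ x → c * g x) ≡ c * ∑ xs g
∑-*ˡ []       c g = sym (ℤ.*-zeroʳ c)
∑-*ˡ (x ∷ xs) c g = trans (cong (_+_ (c * g x)) (∑-*ˡ xs c g)) (sym (ℤ.*-distribˡ-+ c (g x) _))

∑-*ʳ : ∀ (xs : List A) (c : ℤ) (g : A → ℤ) → ∑ xs (λ x → g x * c) ≡ ∑ xs g * c
∑-*ʳ []       c g = sym (ℤ.*-zeroˡ c)
∑-*ʳ (x ∷ xs) c g = trans (cong (_+_ (g x * c)) (∑-*ʳ xs c g)) (sym (ℤ.*-distribʳ-+ c (g x) _))

∑-+ : ∀ (xs : List A) (g h : A → ℤ) → ∑ xs (λ x → g x + h x) ≡ ∑ xs g + ∑ xs h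
∑-+ []       g h = refl
∑-+ (x ∷ xs) g h = trans (cong (_+_ (g x + h x)) (∑-+ xs g h)) (interchange (g x) (h x) _ _)
  where
  interchange : ∀ a b c d → (a + b) + (c + d) ≡ (a + c) + (b + d)
  interchange = solve-∀

∑-zero : ∀ (xs : List A) → ∑ xs (λ _ → + 0) ≡ + 0
∑-zero []       = refl
∑-zero (x ∷ xs) = trans (ℤ.+-identityˡ _) (∑-zero xs)

∑-swap : (xs : List A) (ys : List B) (g : A → B → ℤ) →
         ∑ xs (λ x → ∑ ys (g x)) ≡ ∑ ys (λ y → ∑ xs (λ x → g x y))
∑-swap []       ys g = sym (∑-zero ys)
∑-swap (x ∷ xs) ys g = trans (cong (_+_ (∑ ys (g x))) (∑-swap xs ys g)) (sym (∑-+ ys (g x) _))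

∑-if-* : ∀ β c (xs : List A) g →
         ∑ xs (λ x → if β then c * g x else + 0) ≡ (if β then c * ∑ xs g else + 0)
∑-if-* true  c xs g = ∑-*ˡ xs c g
∑-if-* false c xs g = ∑-zero xs

⟦_⟧ : Bool → ℤ
⟦ b ⟧ = if b then + 1 else + 0

⟦∧⟧ : ∀ b c → ⟦ b ∧ c ⟧ ≡ ⟦ b ⟧ * ⟦ c ⟧
⟦∧⟧ true  c = sym (ℤ.*-identityˡ ⟦ c ⟧)
⟦∧⟧ false c = sym (ℤ.*-zeroˡ ⟦ c ⟧)

∑-filterᵇ : ∀ (p : A → Bool) (xs : List A) (g : A → ℤ) →
            ∑ (filterᵇ p xs) g ≡ ∑ xs (λ x → ⟦ p x ⟧ * g x)
∑-filterᵇ p []       g = refl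
∑-filterᵇ p (x ∷ xs) g with p x
... | true  = cong₂ _+_ (sym (ℤ.*-identityˡ (g x))) (∑-filterᵇ p xs g)
... | false = trans (∑-filterᵇ p xs g)
                    (sym (trans (cong (_+ rest) (ℤ.*-zeroˡ (g x))) (ℤ.+-identityˡ rest)))
  where rest = ∑ xs (λ y → ⟦ p y ⟧ * g y)

∑-⟦⟧≡1⇒Any : ∀ (p : A → Bool) (xs : List A) → ∑ xs (λ x → ⟦ p x ⟧) ≡ + 1 → Any (T ∘ p) xs
∑-⟦⟧≡1⇒Any p (x ∷ xs) sum≡1 with p x in px
... | true  = here (subst T (sym px) tt)
... | false = there (∑-⟦⟧≡1⇒Any p xs (trans (sym (ℤ.+-identityˡ _)) sum≡1))

∏ : ∀ {n} → (Fin n → ℤ) → ℤ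
∏ {zero}  g = + 1
∏ {suc n} g = g zero * ∏ (g ∘ suc)

∏-cong : ∀ {n} {g h : Fin n → ℤ} → (∀ i → g i ≡ h i) → ∏ g ≡ ∏ h
∏-cong {zero}  g≡h = refl
∏-cong {suc n} g≡h = cong₂ _*_ (g≡h zero) (∏-cong (g≡h ∘ suc))

∏-1 : ∀ n → ∏ {n} (λ _ → + 1) ≡ + 1
∏-1 zero    = refl
∏-1 (suc n) = trans (ℤ.*-identityˡ _) (∏-1 n)

∏-linearAt : ∀ {n} (g : Fin n → ℤ) (i : Fin n) →
             ∃ λ r → ∀ h → (∀ j → j ≢ i → h j ≡ g j) → ∏ h ≡ h i * r
∏-linearAt g zero    = ∏ (g ∘ suc) , λ h h≗g → cong (h zero *_) (∏-cong (λ j → h≗g (suc j) λ ()))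
∏-linearAt g (suc i) = let r , ∏≡ = ∏-linearAt (g ∘ suc) i in g zero * r , λ h h≗g →
  begin
    h zero * ∏ (h ∘ suc)
      ≡⟨ cong₂ _*_ (h≗g zero λ ()) (∏≡ (h ∘ suc) (λ j j≢i → h≗g (suc j) (j≢i ∘ suc-injective))) ⟩
    g zero * (h (suc i) * r)
      ≡⟨ swap-front (g zero) (h (suc i)) r ⟩
    h (suc i) * (g zero * r)
  ∎
  where
  swap-front : ∀ a b c → a * (b * c) ≡ b * (a * c)
  swap-front = solve-∀

∑-allFuns : ∀ {A : Set} n (xs : List A) (w : Fin n → A → ℤ) →
            ∑ (allFuns n xs) (λ f → ∏ (λ i → w i (f i))) ≡ ∏ (λ i → ∑ xs (w i))
∑-allFuns     zero    xs w = ℤ.+-identityʳ (+ 1)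
∑-allFuns {A} (suc n) xs w = begin
  ∑ (allFuns (suc n) xs) G
    ≡⟨ ∑-concatMap (λ a → map _ (allFuns n xs)) xs G ⟩
  ∑ xs (λ a → ∑ (map _ (allFuns n xs)) G)
    ≡⟨ ∑-cong xs (λ a _ → ∑-map _ (allFuns n xs) G) ⟩
  ∑ xs (λ a → ∑ (allFuns n xs) (λ f → w zero a * G′ f))
    ≡⟨ ∑-cong xs (λ a _ → ∑-*ˡ (allFuns n xs) (w zero a) G′) ⟩
  ∑ xs (λ a → w zero a * ∑ (allFuns n xs) G′)
    ≡⟨ ∑-cong xs (λ a _ → cong (w zero a *_) (∑-allFuns n xs (w ∘ suc))) ⟩
  ∑ xs (λ a → w zero a * ∏ (λ i → ∑ xs (w (suc i))))
    ≡⟨ ∑-*ʳ xs _ (w zero) ⟩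
  ∑ xs (w zero) * ∏ (λ i → ∑ xs (w (suc i)))
  ∎
  where
  G : (Fin (suc n) → A) → ℤ
  G f = ∏ (λ i → w i (f i))
  G′ : (Fin n → A) → ℤ
  G′ f = ∏ (λ i → w (suc i) (f i))

T-injective : ∀ {b c} → T b ⇔ T c → b ≡ c
T-injective {false} {false} _   = refl
T-injective {false} {true}  b⇔c = ⊥-elim (from b⇔c tt)
T-injective {true}  {false} b⇔c = ⊥-elim (to b⇔c tt)
T-injective {true}  {true}  _   = refl

T-not : ∀ {b} → T (not b) ⇔ (¬ T b)
T-not {true}  = mk⇔ (λ ()) (λ ¬t → ¬t tt)
T-not {false} = mk⇔ (λ _ ()) (λ _ → tt)

T-not-∨ : ∀ {a b} → T (not a ∨ b) ⇔ (T a → T b)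
T-not-∨ {true}  = mk⇔ (λ tb _ → tb) (λ a⇒b → a⇒b tt)
T-not-∨ {false} = mk⇔ (λ _ ()) (λ _ → tt)

not-≡ : ∀ {b c} → T b ⇔ (¬ T c) → not b ≡ c
not-≡ {true}  {true}  b⇔¬c = ⊥-elim (to b⇔¬c tt tt)
not-≡ {true}  {false} _    = refl
not-≡ {false} {true}  _    = refl
not-≡ {false} {false} b⇔¬c = ⊥-elim (from b⇔¬c λ ())

⌊⌋-⇔ : ∀ {P Q : Set} → P ⇔ Q → (p? : Dec P) (q? : Dec Q) → ⌊ p? ⌋ ≡ ⌊ q? ⌋
⌊⌋-⇔ P⇔Q p? q? = trans (isYes≗does p?) (trans (does-⇔ P⇔Q p? q?) (sym (isYes≗does q?)))

⌊s≤?s⌋ : ∀ m n → ⌊ suc m ℕ.≤? suc n ⌋ ≡ ⌊ m ℕ.≤? n ⌋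
⌊s≤?s⌋ m n = ⌊⌋-⇔ (mk⇔ ℕ.s≤s⁻¹ ℕ.s≤s) _ _

⌊s≟s⌋ : ∀ m n → ⌊ suc m ℕ.≟ suc n ⌋ ≡ ⌊ m ℕ.≟ n ⌋
⌊s≟s⌋ m n = ⌊⌋-⇔ (mk⇔ ℕ.suc-injective (cong suc)) _ _

⌊+≤?⌋ : ∀ m n k → ⌊ m ℕ.+ n ℕ.≤? k ⌋ ≡ ⌊ m ℕ.≤? k ⌋ ∧ ⌊ n ℕ.≤? k ∸ m ⌋
⌊+≤?⌋ zero    n k       = refl
⌊+≤?⌋ (suc m) n zero    = refl
⌊+≤?⌋ (suc m) n (suc k) =
  trans (⌊s≤?s⌋ (m ℕ.+ n) k)
        (trans (⌊+≤?⌋ m n k) (cong (_∧ ⌊ n ℕ.≤? k ∸ m ⌋) (sym (⌊s≤?s⌋ m k))))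

⌊≟⌋-via-≤? : ∀ m n → ⌊ m ℕ.≟ n ⌋ ≡ ⌊ m ℕ.≤? n ⌋ ∧ ⌊ n ∸ m ℕ.≟ 0 ⌋
⌊≟⌋-via-≤? zero    zero    = refl
⌊≟⌋-via-≤? zero    (suc n) = refl
⌊≟⌋-via-≤? (suc m) zero    = refl
⌊≟⌋-via-≤? (suc m) (suc n) =
  trans (⌊s≟s⌋ m n) (trans (⌊≟⌋-via-≤? m n) (cong (_∧ ⌊ n ∸ m ℕ.≟ 0 ⌋) (sym (⌊s≤?s⌋ m n))))

allB-suc : ∀ {n} (p : Fin (suc n) → Bool) → allB p ≡ p zero ∧ allB (p ∘ suc)
allB-suc p = cong (λ bs → p zero ∧ and bs)
                  (trans (List.map-tabulate suc p) (sym (List.map-tabulate (λ i → i) (p ∘ suc))))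

allB-cong : ∀ {n} {p q : Fin n → Bool} → (∀ i → p i ≡ q i) → allB p ≡ allB q
allB-cong {n} p≗q = cong and (List.map-cong p≗q (allFin n))

allB-∧ : ∀ {n} (p q : Fin n → Bool) → allB (λ i → p i ∧ q i) ≡ allB p ∧ allB q
allB-∧ {zero}  p q = refl
allB-∧ {suc n} p q = begin
  allB (λ i → p i ∧ q i)
    ≡⟨ allB-suc (λ i → p i ∧ q i) ⟩
  (p zero ∧ q zero) ∧ allB (λ i → p (suc i) ∧ q (suc i))
    ≡⟨ cong ((p zero ∧ q zero) ∧_) (allB-∧ (p ∘ suc) (q ∘ suc)) ⟩
  (p zero ∧ q zero) ∧ (allB (p ∘ suc) ∧ allB (q ∘ suc))
    ≡⟨ interchange (p zero) (q zero) _ _ ⟩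
  (p zero ∧ allB (p ∘ suc)) ∧ (q zero ∧ allB (q ∘ suc))
    ≡⟨ sym (cong₂ _∧_ (allB-suc p) (allB-suc q)) ⟩
  allB p ∧ allB q
  ∎
  where
  interchange : ∀ a b c d → (a ∧ b) ∧ (c ∧ d) ≡ (a ∧ c) ∧ (b ∧ d)
  interchange false b c     d = refl
  interchange true  b false d = Bool.∧-zeroʳ b
  interchange true  b true  d = refl

T-allB : ∀ {n} {p : Fin n → Bool} → T (allB p) ⇔ (∀ i → T (p i))
T-allB {p = p} = mk⇔ (λ t i → All.lookup (all⁺ p (allFin _) t) (∈-allFin i))
                     (λ h → all⁻ p {allFin _} (All.tabulate (λ {i} _ → h i)))

∏-⟦⟧ : ∀ {n} (p : Fin n → Bool) → ∏ (λ i → ⟦ p i ⟧) ≡ ⟦ allB p ⟧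
∏-⟦⟧ {zero}  p = refl
∏-⟦⟧ {suc n} p = begin
  ⟦ p zero ⟧ * ∏ (λ i → ⟦ p (suc i) ⟧)  ≡⟨ cong (⟦ p zero ⟧ *_) (∏-⟦⟧ (p ∘ suc)) ⟩
  ⟦ p zero ⟧ * ⟦ allB (p ∘ suc) ⟧       ≡⟨ sym (⟦∧⟧ (p zero) _) ⟩
  ⟦ p zero ∧ allB (p ∘ suc) ⟧           ≡⟨ cong ⟦_⟧ (sym (allB-suc p)) ⟩
  ⟦ allB p ⟧                            ∎

allB₂ : (Fin nX → Fin nY → Bool) → Bool
allB₂ p = allB λ x → allB (p x)

T-allB₂ : ∀ {p : Fin nX → Fin nY → Bool} → T (allB₂ p) ⇔ (∀ x y → T (p x y))
T-allB₂ = mk⇔ (λ t x → to T-allB (to T-allB t x)) (λ h → from T-allB λ x → from T-allB (h x))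

allB₂-∧ : (p q : Fin nX → Fin nY → Bool) → allB₂ (λ x y → p x y ∧ q x y) ≡ allB₂ p ∧ allB₂ q
allB₂-∧ p q = trans (allB-cong λ x → allB-∧ (p x) (q x)) (allB-∧ (λ x → allB (p x)) (λ x → allB (q x)))

∏₂-⟦⟧ : (p : Fin nX → Fin nY → Bool) → (∏ λ x → ∏ λ y → ⟦ p x y ⟧) ≡ ⟦ allB₂ p ⟧
∏₂-⟦⟧ p = trans (∏-cong λ x → ∏-⟦⟧ (p x)) (∏-⟦⟧ (λ x → allB (p x)))

_≐_ : {C : Set} → (Fin nX → Fin nY → C) → (Fin nX → Fin nY → C) → Set
f ≐ g = ∀ x y → f x y ≡ g x y

≐-sym : ∀ {C : Set} {f g : Fin nX → Fin nY → C} → f ≐ g → g ≐ f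
≐-sym f≐g x y = sym (f≐g x y)

≐-trans : ∀ {C : Set} {f g h : Fin nX → Fin nY → C} → f ≐ g → g ≐ h → f ≐ h
≐-trans f≐g g≐h x y = trans (f≐g x y) (g≐h x y)

_⊆_ : SetTab nX nY → SetTab nX nY → Set
F ⊆ G = ∀ x y → T (F x y) → T (G x y)

⊆-trans : ∀ {F G H : SetTab nX nY} → F ⊆ G → G ⊆ H → F ⊆ H
⊆-trans F⊆G G⊆H x y = G⊆H x y ∘ F⊆G x y

≐⇒⊆ : ∀ {F G : SetTab nX nY} → F ≐ G → F ⊆ G
≐⇒⊆ F≐G x y = subst T (F≐G x y)

∖-⊆ : ∀ (E F : SetTab nX nY) → (E ∖ F) ⊆ E
∖-⊆ E F x y = proj₁ ∘ to Bool.T-∧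

∖-antitone : ∀ (E : SetTab nX nY) {F G} → F ⊆ G → (E ∖ G) ⊆ (E ∖ F)
∖-antitone E {F} {G} F⊆G x y with E x y | F x y | G x y | F⊆G x y
... | false | _     | _     | _   = λ ()
... | true  | false | _     | _   = λ _ → tt
... | true  | true  | true  | _   = λ ()
... | true  | true  | false | f⇒g = λ _ → f⇒g tt

∖-cong : ∀ (E : SetTab nX nY) {F G} → F ≐ G → (E ∖ F) ≐ (E ∖ G)
∖-cong E F≐G x y = cong (λ b → E x y ∧ not b) (F≐G x y)

∖-involutive : ∀ {E S : SetTab nX nY} → S ⊆ E → (E ∖ (E ∖ S)) ≐ S
∖-involutive {E = E} {S} S⊆E x y with E x y | S x y | S⊆E x y
... | true  | true  | _   = refl
... | true  | false | _   = refl
... | false | false | _   = refl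
... | false | true  | s⇒e = ⊥-elim (s⇒e tt)

∖-swap : ∀ {E F G : SetTab nX nY} → F ⊆ E → G ≐ (E ∖ F) → F ≐ (E ∖ G)
∖-swap {E = E} F⊆E G≐E∖F = ≐-trans (≐-sym (∖-involutive F⊆E)) (∖-cong E (≐-sym G≐E∖F))

T-⊆ᵇ : ∀ {F G : SetTab nX nY} → T (F ⊆ᵇ G) ⇔ F ⊆ G
T-⊆ᵇ = mk⇔ (λ t x y → to T-not-∨ (to T-allB₂ t x y))
           (λ F⊆G → from T-allB₂ λ x y → from T-not-∨ (F⊆G x y))

_≗ᵇ_ : SetTab nX nY → SetTab nX nY → Bool
F ≗ᵇ G = allB₂ λ x y → ⌊ F x y Bool.≟ G x y ⌋

T-≗ᵇ : ∀ {F G : SetTab nX nY} → T (F ≗ᵇ G) ⇔ F ≐ G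
T-≗ᵇ = mk⇔ (λ t x y → toWitness (to T-allB₂ t x y))
           (λ F≐G → from T-allB₂ λ x y → fromWitness (F≐G x y))

T-≐ᵇ : ∀ {F G : SetTab nX nY} → T (F ≐ᵇ G) ⇔ F ≐ G
T-≐ᵇ {F = F} {G} = mk⇔
  (λ t → let F⊆G , G⊆F = to (Bool.T-∧ {F ⊆ᵇ G} {G ⊆ᵇ F}) t
         in λ x y → T-injective (mk⇔ (to (T-⊆ᵇ {F = F}) F⊆G x y) (to (T-⊆ᵇ {F = G}) G⊆F x y)))
  (λ F≐G → from Bool.T-∧ (from T-⊆ᵇ (≐⇒⊆ F≐G) , from T-⊆ᵇ (≐⇒⊆ (≐-sym F≐G))))

isAt : Fin nX → Fin nY → Fin nX → Fin nY → Bool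
isAt x₀ y₀ x y = ⌊ x Fin.≟ x₀ ⌋ ∧ ⌊ y Fin.≟ y₀ ⌋

isAt-self : ∀ (x₀ : Fin nX) (y₀ : Fin nY) → isAt x₀ y₀ x₀ y₀ ≡ true
isAt-self x₀ y₀ =
  cong₂ _∧_ (cong ⌊_⌋ (≡-≟-identity Fin._≟_ {x₀} refl)) (cong ⌊_⌋ (≡-≟-identity Fin._≟_ {y₀} refl))

isAt-other : ∀ {x₀ x : Fin nX} {y₀ y : Fin nY} → (x , y) ≢ (x₀ , y₀) → isAt x₀ y₀ x y ≡ false
isAt-other {x₀ = x₀} {x} {y₀} {y} ne with x Fin.≟ x₀ | y Fin.≟ y₀
... | yes refl | yes refl = ⊥-elim (ne refl)
... | yes _    | no _     = refl
... | no _     | _        = refl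

unitExp-self : ∀ (x₀ : Fin nX) (y₀ : Fin nY) → unitExp x₀ y₀ x₀ y₀ ≡ 1
unitExp-self x₀ y₀ = cong (λ β → if β then 1 else 0) (isAt-self x₀ y₀)

unitExp-other : ∀ {x₀ x : Fin nX} {y₀ y : Fin nY} → (x , y) ≢ (x₀ , y₀) → unitExp x₀ y₀ x y ≡ 0
unitExp-other ne = cong (λ β → if β then 1 else 0) (isAt-other ne)

zeroExp-≤ₑ : (a : Exp nX nY) → (zeroExp ≤ₑ a) ≡ true
zeroExp-≤ₑ a = to Bool.T-≡ (from (T-allB₂ {p = λ x y → ⌊ 0 ℕ.≤? a x y ⌋}) λ _ _ → tt)

unitExp-≤ₑ : ∀ (x₀ : Fin nX) (y₀ : Fin nY) a → (unitExp x₀ y₀ ≤ₑ a) ≡ ⌊ 1 ℕ.≤? a x₀ y₀ ⌋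
unitExp-≤ₑ x₀ y₀ a = T-injective (mk⇔ at-x₀y₀ everywhere)
  where
  at-x₀y₀ : T (unitExp x₀ y₀ ≤ₑ a) → T ⌊ 1 ℕ.≤? a x₀ y₀ ⌋
  at-x₀y₀ t = subst (λ k → T ⌊ k ℕ.≤? a x₀ y₀ ⌋) (unitExp-self x₀ y₀) (to T-allB₂ t x₀ y₀)
  everywhere : T ⌊ 1 ℕ.≤? a x₀ y₀ ⌋ → T (unitExp x₀ y₀ ≤ₑ a)
  everywhere t = from T-allB₂ pointwise
    where
    pointwise : ∀ x y → T ⌊ unitExp x₀ y₀ x y ℕ.≤? a x y ⌋
    pointwise x y with ≡-dec Fin._≟_ Fin._≟_ (x , y) (x₀ , y₀)
    ... | yes refl = subst (λ k → T ⌊ k ℕ.≤? a x₀ y₀ ⌋) (sym (unitExp-self x₀ y₀)) t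
    ... | no ne    = subst (λ k → T ⌊ k ℕ.≤? a x y ⌋) (sym (unitExp-other ne)) tt

≤ₑ-+ₑ : ∀ (a b b′ : Exp nX nY) → ((b +ₑ b′) ≤ₑ a) ≡ (b ≤ₑ a) ∧ (b′ ≤ₑ (a ∸ₑ b))
≤ₑ-+ₑ a b b′ = trans (allB-cong λ x → allB-cong λ y → ⌊+≤?⌋ (b x y) (b′ x y) (a x y))
                     (allB₂-∧ (λ x y → ⌊ b x y ℕ.≤? a x y ⌋) (λ x y → ⌊ b′ x y ℕ.≤? a x y ∸ b x y ⌋))

≡ₑ-via-≤ₑ : ∀ (a b : Exp nX nY) →
            (b ≡ₑ a) ≡ (b ≤ₑ a) ∧ allB₂ (λ x y → ⌊ a x y ∸ b x y ℕ.≟ 0 ⌋)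
≡ₑ-via-≤ₑ a b = trans (allB-cong λ x → allB-cong λ y → ⌊≟⌋-via-≤? (b x y) (a x y))
                      (allB₂-∧ (λ x y → ⌊ b x y ℕ.≤? a x y ⌋) (λ x y → ⌊ a x y ∸ b x y ℕ.≟ 0 ⌋))

allPairs≡cartesianProduct : ∀ nX nY → allPairs nX nY ≡ cartesianProduct (allFin nX) (allFin nY)
allPairs≡cartesianProduct nX nY = go (allFin nX)
  where
  go : ∀ xs → concatMap (λ x → map (x ,_) (allFin nY)) xs ≡ cartesianProduct xs (allFin nY)
  go []       = refl
  go (x ∷ xs) = cong (map (x ,_) (allFin nY) ++_) (go xs)

allPairs-unique : Unique (allPairs nX nY)
allPairs-unique {nX} {nY} = subst Unique (sym (allPairs≡cartesianProduct nX nY))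
                                  (Unique.cartesianProduct⁺ (Unique.allFin⁺ nX) (Unique.allFin⁺ nY))

allPairs-complete : ∀ (x : Fin nX) (y : Fin nY) → (x , y) ∈ allPairs nX nY
allPairs-complete {nX} {nY} x y = subst ((x , y) ∈_) (sym (allPairs≡cartesianProduct nX nY))
                                        (∈-cartesianProduct⁺ (∈-allFin x) (∈-allFin y))

-- Polynomials acting on power series

Extensional : (Exp nX nY → ℤ) → Set
Extensional H = ∀ {a b} → a ≐ b → H a ≡ H b

-- (H ⊛ p) a unfolds to ∑ p (act H a), and coeff p a to ∑ p (λ (c , b) → if b ≡ₑ a then c else + 0).
act : (Exp nX nY → ℤ) → Exp nX nY → ℤ × Exp nX nY → ℤ
act H a (c , b) = if b ≤ₑ a then c * H (a ∸ₑ b) else + 0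

⊛-cong : ∀ {H H′ : Exp nX nY → ℤ} → (∀ a → H a ≡ H′ a) → ∀ p a → (H ⊛ p) a ≡ (H′ ⊛ p) a
⊛-cong H≗H′ p a = ∑-cong p λ (c , b) _ → cong (λ z → if b ≤ₑ a then c * z else + 0) (H≗H′ (a ∸ₑ b))

⊛-∑ : ∀ (G : A → Exp nX nY → ℤ) xs p a →
      ((λ b → ∑ xs (λ F → G F b)) ⊛ p) a ≡ ∑ xs (λ F → (G F ⊛ p) a)
⊛-∑ G xs p a = trans (∑-cong p λ (c , b) _ → sym (∑-if-* (b ≤ₑ a) c xs (λ F → G F (a ∸ₑ b))))
                     (∑-swap p xs (λ t F → act (G F) a t))

act-+ₑ : ∀ {H : Exp nX nY → ℤ} → Extensional H → ∀ a c d b b′ →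
         act H a (c * d , b +ₑ b′) ≡ (if b ≤ₑ a then c * act H (a ∸ₑ b) (d , b′) else + 0)
act-+ₑ {H = H} ext a c d b b′
  rewrite ≤ₑ-+ₑ a b b′
        | ext {a ∸ₑ (b +ₑ b′)} {(a ∸ₑ b) ∸ₑ b′} (λ x y → sym (ℕ.∸-+-assoc (a x y) (b x y) (b′ x y)))
  with b ≤ₑ a | b′ ≤ₑ (a ∸ₑ b)
... | true  | true  = ℤ.*-assoc c d _
... | true  | false = sym (ℤ.*-zeroʳ c)
... | false | _     = refl

⊛-*P : ∀ {H : Exp nX nY → ℤ} → Extensional H → ∀ p q a → (H ⊛ (p *P q)) a ≡ ((H ⊛ q) ⊛ p) a
⊛-*P         ext []            q a = refl
⊛-*P {H = H} ext ((c , b) ∷ p) q a = begin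
  ∑ (map scale q ++ (p *P q)) (act H a)         ≡⟨ ∑-++ (map scale q) (p *P q) (act H a) ⟩
  ∑ (map scale q) (act H a) + (H ⊛ (p *P q)) a  ≡⟨ cong₂ _+_ head-term (⊛-*P ext p q a) ⟩
  act (H ⊛ q) a (c , b) + ((H ⊛ q) ⊛ p) a       ∎
  where
  scale : ℤ × Exp _ _ → ℤ × Exp _ _
  scale (d , b′) = c * d , b +ₑ b′
  head-term : ∑ (map scale q) (act H a) ≡ act (H ⊛ q) a (c , b)
  head-term = begin
    ∑ (map scale q) (act H a)
      ≡⟨ ∑-map scale q (act H a) ⟩
    ∑ q (λ (d , b′) → act H a (c * d , b +ₑ b′))
      ≡⟨ ∑-cong q (λ (d , b′) _ → act-+ₑ ext a c d b b′) ⟩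
    ∑ q (λ t → if b ≤ₑ a then c * act H (a ∸ₑ b) t else + 0)
      ≡⟨ ∑-if-* (b ≤ₑ a) c q (act H (a ∸ₑ b)) ⟩
    act (H ⊛ q) a (c , b)
    ∎

-- Product series

-- One univariate power series, by its coefficient function, for each variable t_(x,y).
Family : ℕ → ℕ → Set
Family nX nY = Fin nX → Fin nY → ℕ → ℤ

Π : Family nX nY → Exp nX nY → ℤ
Π φ a = ∏ λ x → ∏ λ y → φ x y (a x y)

Π-cong : ∀ {φ ψ : Family nX nY} {a b} → (∀ x y → φ x y (a x y) ≡ ψ x y (b x y)) → Π φ a ≡ Π ψ b
Π-cong eq = ∏-cong λ x → ∏-cong λ y → eq x y

Π-extensional : (φ : Family nX nY) → Extensional (Π φ)
Π-extensional φ {a} {b} a≐b = Π-cong {φ = φ} {ψ = φ} {a} {b} λ x y → cong (φ x y) (a≐b x y)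

Π-linearAt : ∀ (φ : Family nX nY) (a : Exp nX nY) x₀ y₀ →
             ∃ λ r → ∀ (ψ : Family nX nY) (b : Exp nX nY) →
                     (∀ x y → (x , y) ≢ (x₀ , y₀) → ψ x y (b x y) ≡ φ x y (a x y)) →
                     Π ψ b ≡ ψ x₀ y₀ (b x₀ y₀) * r
Π-linearAt φ a x₀ y₀ =
  let r₁ , inner = ∏-linearAt (λ y → φ x₀ y (a x₀ y)) y₀
      r₂ , outer = ∏-linearAt (λ x → ∏ λ y → φ x y (a x y)) x₀
  in r₁ * r₂ , λ ψ b agree → begin
    Π ψ b
      ≡⟨ outer (λ x → ∏ λ y → ψ x y (b x y))
               (λ x x≢x₀ → ∏-cong λ y → agree x y (x≢x₀ ∘ cong proj₁)) ⟩
    (∏ λ y → ψ x₀ y (b x₀ y)) * r₂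
      ≡⟨ cong (_* r₂) (inner (λ y → ψ x₀ y (b x₀ y)) (λ y y≢y₀ → agree x₀ y (y≢y₀ ∘ cong proj₂))) ⟩
    ψ x₀ y₀ (b x₀ y₀) * r₁ * r₂
      ≡⟨ ℤ.*-assoc (ψ x₀ y₀ (b x₀ y₀)) r₁ r₂ ⟩
    ψ x₀ y₀ (b x₀ y₀) * (r₁ * r₂)
    ∎

-- A polynomial of degree ≤ 1 in a single variable t; the flag marks the terms c · t.
Poly₁ : Set
Poly₁ = List (ℤ × Bool)

powExp : Fin nX → Fin nY → Bool → Exp nX nY
powExp x y e = if e then unitExp x y else zeroExp

embed : Fin nX → Fin nY → Poly₁ → Poly nX nY
embed x y = map λ (c , e) → c , powExp x y e

timesT : (ℕ → ℤ) → ℕ → ℤ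
timesT h zero    = + 0
timesT h (suc n) = h n

act₁ : (ℕ → ℤ) → ℕ → ℤ × Bool → ℤ
act₁ h n (c , false) = c * h n
act₁ h n (c , true)  = c * timesT h n

_⊛₁_ : (ℕ → ℤ) → Poly₁ → ℕ → ℤ
(h ⊛₁ Q) n = ∑ Q (act₁ h n)

⊛₁-cong : ∀ {h h′ : ℕ → ℤ} → (∀ n → h n ≡ h′ n) → ∀ Q n → (h ⊛₁ Q) n ≡ (h′ ⊛₁ Q) n
⊛₁-cong {h = h} {h′} h≗h′ Q n = ∑-cong Q {act₁ h n} {act₁ h′ n} λ
  { (c , false) _ → cong (c *_) (h≗h′ n)
  ; (c , true)  _ → cong (c *_) (timesT-cong n) }
  where
  timesT-cong : ∀ n → timesT h n ≡ timesT h′ n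
  timesT-cong zero    = refl
  timesT-cong (suc n) = h≗h′ n

Π-embed : ∀ (φ ψ : Family nX nY) x₀ y₀ (Q : Poly₁) a →
          (∀ x y → (x , y) ≢ (x₀ , y₀) → ψ x y (a x y) ≡ φ x y (a x y)) →
          ψ x₀ y₀ (a x₀ y₀) ≡ (φ x₀ y₀ ⊛₁ Q) (a x₀ y₀) →
          (Π φ ⊛ embed x₀ y₀ Q) a ≡ Π ψ a
Π-embed φ ψ x₀ y₀ Q a ψ≈φ ψ-at = begin
  ∑ (embed x₀ y₀ Q) (act (Π φ) a)                     ≡⟨ ∑-map _ Q (act (Π φ) a) ⟩
  ∑ Q (λ (c , e) → act (Π φ) a (c , powExp x₀ y₀ e))  ≡⟨ ∑-cong Q (λ (c , e) _ → term c e) ⟩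
  ∑ Q (λ t → act₁ (φ x₀ y₀) (a x₀ y₀) t * r)          ≡⟨ ∑-*ʳ Q r (act₁ (φ x₀ y₀) (a x₀ y₀)) ⟩
  (φ x₀ y₀ ⊛₁ Q) (a x₀ y₀) * r                        ≡⟨ cong (_* r) (sym ψ-at) ⟩
  ψ x₀ y₀ (a x₀ y₀) * r                               ≡⟨ sym (factor ψ a ψ≈φ) ⟩
  Π ψ a                                               ∎
  where
  r = proj₁ (Π-linearAt φ a x₀ y₀)
  factor = proj₂ (Π-linearAt φ a x₀ y₀)
  term : ∀ c e → act (Π φ) a (c , powExp x₀ y₀ e) ≡ act₁ (φ x₀ y₀) (a x₀ y₀) (c , e) * r
  term c false = begin
    (if zeroExp ≤ₑ a then c * Π φ a else + 0)
      ≡⟨ cong (λ β → if β then c * Π φ a else + 0) (zeroExp-≤ₑ a) ⟩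
    c * Π φ a
      ≡⟨ cong (c *_) (factor φ a λ _ _ _ → refl) ⟩
    c * (φ x₀ y₀ (a x₀ y₀) * r)
      ≡⟨ sym (ℤ.*-assoc c _ r) ⟩
    c * φ x₀ y₀ (a x₀ y₀) * r
    ∎
  term c true = trans (cong (λ β → if β then shiftedTerm else + 0) (unitExp-≤ₑ x₀ y₀ a))
                      (shifted (a x₀ y₀) refl)
    where
    shiftedTerm = c * Π φ (a ∸ₑ unitExp x₀ y₀)
    shifted : ∀ k → a x₀ y₀ ≡ k →
              (if ⌊ 1 ℕ.≤? k ⌋ then shiftedTerm else + 0) ≡ c * timesT (φ x₀ y₀) k * r
    unchanged-off-x₀y₀ : ∀ x y → (x , y) ≢ (x₀ , y₀) →
                         φ x y (a x y ∸ unitExp x₀ y₀ x y) ≡ φ x y (a x y)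
    unchanged-off-x₀y₀ x y ne = cong (λ k → φ x y (a x y ∸ k)) (unitExp-other ne)
    shifted zero    _   = sym (trans (cong (_* r) (ℤ.*-zeroʳ c)) (ℤ.*-zeroˡ r))
    shifted (suc m) a₀≡ = begin
      c * Π φ (a ∸ₑ unitExp x₀ y₀)
        ≡⟨ cong (c *_) (factor φ (a ∸ₑ unitExp x₀ y₀) unchanged-off-x₀y₀) ⟩
      c * (φ x₀ y₀ (a x₀ y₀ ∸ unitExp x₀ y₀ x₀ y₀) * r)
        ≡⟨ cong (λ k → c * (φ x₀ y₀ k * r)) (cong₂ _∸_ a₀≡ (unitExp-self x₀ y₀)) ⟩
      c * (φ x₀ y₀ m * r)
        ≡⟨ sym (ℤ.*-assoc c _ r) ⟩
      c * φ x₀ y₀ m * r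
      ∎

_[_,_]≔_ : Family nX nY → Fin nX → Fin nY → (ℕ → ℤ) → Family nX nY
(ψ [ x₀ , y₀ ]≔ h) x y = if isAt x₀ y₀ x y then h else ψ x y

update-self : ∀ (ψ : Family nX nY) x₀ y₀ h n → (ψ [ x₀ , y₀ ]≔ h) x₀ y₀ n ≡ h n
update-self ψ x₀ y₀ h n = cong (λ β → (if β then h else ψ x₀ y₀) n) (isAt-self x₀ y₀)

update-other : ∀ (ψ : Family nX nY) {x₀ x y₀ y} h → (x , y) ≢ (x₀ , y₀) →
               ∀ n → (ψ [ x₀ , y₀ ]≔ h) x y n ≡ ψ x y n
update-other ψ {x = x} {y = y} h ne n = cong (λ β → (if β then h else ψ x y) n) (isAt-other ne)

prodOver : List (Fin nX × Fin nY) → (Fin nX → Fin nY → Poly nX nY) → Poly nX nY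
prodOver L P = foldr (λ (x , y) acc → P x y *P acc) oneP L

module _ (P : Fin nX → Fin nY → Poly nX nY) (Q : Fin nX → Fin nY → Poly₁)
         (P≡embedQ : ∀ x y → P x y ≡ embed x y (Q x y)) where

  Π-prodOver : ∀ L → Unique L → ∀ (φ ψ : Family nX nY) →
               (∀ x y → (x , y) ∈ L → ∀ n → ψ x y n ≡ (φ x y ⊛₁ Q x y) n) →
               (∀ x y → (x , y) ∉ L → ∀ n → ψ x y n ≡ φ x y n) →
               ∀ a → (Π φ ⊛ prodOver L P) a ≡ Π ψ a
  Π-prodOver [] [] φ ψ _ off a = begin
    act (Π φ) a (+ 1 , zeroExp) + + 0  ≡⟨ ℤ.+-identityʳ _ ⟩
    act (Π φ) a (+ 1 , zeroExp)        ≡⟨ cong (λ β → if β then + 1 * Π φ a else + 0) (zeroExp-≤ₑ a) ⟩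
    + 1 * Π φ a                        ≡⟨ ℤ.*-identityˡ _ ⟩
    Π φ a                              ≡⟨ Π-cong {φ = φ} {ψ} {a} {a} (λ x y → sym (off x y (λ ()) (a x y))) ⟩
    Π ψ a                              ∎
  Π-prodOver ((x₀ , y₀) ∷ L) (x₀y₀∉L ∷ uniqueL) φ ψ on off a = begin
    (Π φ ⊛ (P x₀ y₀ *P prodOver L P)) a  ≡⟨ ⊛-*P (Π-extensional φ) (P x₀ y₀) (prodOver L P) a ⟩
    ((Π φ ⊛ prodOver L P) ⊛ P x₀ y₀) a   ≡⟨ ⊛-cong (Π-prodOver L uniqueL φ ψ′ on′ off′) (P x₀ y₀) a ⟩
    (Π ψ′ ⊛ P x₀ y₀) a                   ≡⟨ cong (λ p → (Π ψ′ ⊛ p) a) (P≡embedQ x₀ y₀) ⟩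
    (Π ψ′ ⊛ embed x₀ y₀ (Q x₀ y₀)) a     ≡⟨ Π-embed ψ′ ψ x₀ y₀ (Q x₀ y₀) a agree at-x₀y₀ ⟩
    Π ψ a                                ∎
    where
    -- ψ before the factor at (x₀ , y₀) has acted
    ψ′ : Family _ _
    ψ′ = ψ [ x₀ , y₀ ]≔ φ x₀ y₀
    on′ : ∀ x y → (x , y) ∈ L → ∀ n → ψ′ x y n ≡ (φ x y ⊛₁ Q x y) n
    on′ x y xy∈L n =
      trans (update-other ψ _ (λ eq → All.lookup x₀y₀∉L xy∈L (sym eq)) n) (on x y (there xy∈L) n)
    off′ : ∀ x y → (x , y) ∉ L → ∀ n → ψ′ x y n ≡ φ x y n
    off′ x y xy∉L n with ≡-dec Fin._≟_ Fin._≟_ (x , y) (x₀ , y₀)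
    ... | yes refl = update-self ψ x₀ y₀ (φ x₀ y₀) n
    ... | no ne    = trans (update-other ψ _ ne n)
                           (off x y (λ { (here eq) → ne eq ; (there xy∈L) → xy∉L xy∈L }) n)
    agree : ∀ x y → (x , y) ≢ (x₀ , y₀) → ψ x y (a x y) ≡ ψ′ x y (a x y)
    agree x y ne = sym (update-other ψ _ ne (a x y))
    at-x₀y₀ : ψ x₀ y₀ (a x₀ y₀) ≡ (ψ′ x₀ y₀ ⊛₁ Q x₀ y₀) (a x₀ y₀)
    at-x₀y₀ = trans (on x₀ y₀ (here refl) (a x₀ y₀))
                    (⊛₁-cong (λ n → sym (update-self ψ x₀ y₀ (φ x₀ y₀) n)) (Q x₀ y₀) (a x₀ y₀))

  Π-prodPairs : ∀ (φ : Family nX nY) a → (Π φ ⊛ prodPairs P) a ≡ Π (λ x y → φ x y ⊛₁ Q x y) a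
  Π-prodPairs φ = Π-prodOver (allPairs _ _) allPairs-unique φ _ (λ _ _ _ _ → refl)
                             (λ x y xy∉ → ⊥-elim (xy∉ (allPairs-complete x y)))

-- Coefficients and the factorwise computation

unitSeries : ℕ → ℤ
unitSeries n = ⟦ ⌊ n ℕ.≟ 0 ⌋ ⟧

coeff-as-action : ∀ (p : Poly nX nY) a → coeff p a ≡ (Π (λ _ _ → unitSeries) ⊛ p) a
coeff-as-action p a = ∑-cong p λ (c , b) _ → term c b
  where
  split : ∀ c β ζ → (if β ∧ ζ then c else + 0) ≡ (if β then c * ⟦ ζ ⟧ else + 0)
  split c true  true  = sym (ℤ.*-identityʳ c)
  split c true  false = sym (ℤ.*-zeroʳ c)
  split c false ζ     = refl
  term : ∀ c b → (if b ≡ₑ a then c else + 0) ≡ act (Π (λ _ _ → unitSeries)) a (c , b)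
  term c b = begin
    (if b ≡ₑ a then c else + 0)
      ≡⟨ cong (λ β → if β then c else + 0) (≡ₑ-via-≤ₑ a b) ⟩
    (if (b ≤ₑ a) ∧ allB₂ isZero then c else + 0)
      ≡⟨ split c (b ≤ₑ a) (allB₂ isZero) ⟩
    (if b ≤ₑ a then c * ⟦ allB₂ isZero ⟧ else + 0)
      ≡⟨ cong (λ z → if b ≤ₑ a then c * z else + 0) (sym (∏₂-⟦⟧ isZero)) ⟩
    act (Π (λ _ _ → unitSeries)) a (c , b)
    ∎
    where
    isZero : Fin _ → Fin _ → Bool
    isZero x y = ⌊ a x y ∸ b x y ℕ.≟ 0 ⌋

-- ∑ tⁿ over the n with (n ≠ 0) = e, that is t/(1 − t) if e and 1 otherwise.
supportSeries : Bool → ℕ → ℤ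
supportSeries e n = ⟦ ⌊ e Bool.≟ not ⌊ n ℕ.≟ 0 ⌋ ⌋ ⟧

supportIndicator : SetTab nX nY → Family nX nY
supportIndicator S x y = supportSeries (S x y)

Π-supportIndicator : ∀ (S : SetTab nX nY) a → Π (supportIndicator S) a ≡ ⟦ S ≗ᵇ supp a ⟧
Π-supportIndicator S a = ∏₂-⟦⟧ λ x y → ⌊ S x y Bool.≟ supp a x y ⌋

one₁ t₁ oneMinusT₁ : Poly₁
one₁       = (+ 1 , false) ∷ []
t₁         = (+ 1 , true) ∷ []
oneMinusT₁ = (+ 1 , false) ∷ (- + 1 , true) ∷ []

denomFactor : Bool → Poly₁
denomFactor e = if e then oneMinusT₁ else one₁

termFactor : Bool → Bool → Poly₁
termFactor e f = if e ∧ not f then t₁ else if f then oneMinusT₁ else one₁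

-- Coefficientwise (t/(1 − t))·(1 − t) = t, 1·(1 − t) = 1 − t and 1·1 = 1.
factorwise : ∀ e f → (T f → T e) → ∀ n →
             (supportSeries (e ∧ not f) ⊛₁ denomFactor e) n ≡ (unitSeries ⊛₁ termFactor e f) n
factorwise true  true  _   zero          = refl
factorwise true  true  _   (suc zero)    = refl
factorwise true  true  _   (suc (suc n)) = refl
factorwise true  false _   zero          = refl
factorwise true  false _   (suc zero)    = refl
factorwise true  false _   (suc (suc n)) = refl
factorwise false false _   zero          = refl
factorwise false false _   (suc n)       = refl
factorwise false true  f⇒e n             = ⊥-elim (f⇒e tt)

tableauTerm-action : ∀ (E F : SetTab nX nY) → F ⊆ E → ∀ a →
                     (Π (supportIndicator (E ∖ F)) ⊛ denomE E) a
                     ≡ (Π (λ _ _ → unitSeries) ⊛ tableauTerm E F) a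
tableauTerm-action E F F⊆E a = begin
  (Π (supportIndicator (E ∖ F)) ⊛ denomE E) a
    ≡⟨ Π-prodPairs _ (λ x y → denomFactor (E x y)) denomE-embed (supportIndicator (E ∖ F)) a ⟩
  Π denomSide a
    ≡⟨ Π-cong {φ = denomSide} {termSide} {a} {a} (λ x y → factorwise (E x y) (F x y) (F⊆E x y) (a x y)) ⟩
  Π termSide a
    ≡⟨ sym (Π-prodPairs _ (λ x y → termFactor (E x y) (F x y)) tableauTerm-embed (λ _ _ → unitSeries) a) ⟩
  (Π (λ _ _ → unitSeries) ⊛ tableauTerm E F) a
  ∎
  where
  denomSide termSide : Family _ _
  denomSide x y = supportSeries ((E ∖ F) x y) ⊛₁ denomFactor (E x y)
  termSide  x y = unitSeries ⊛₁ termFactor (E x y) (F x y)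
  denomE-embed : ∀ x y → (if E x y then oneMinusVarP x y else oneP) ≡ embed x y (denomFactor (E x y))
  denomE-embed x y = sym (Bool.if-float (embed x y) (E x y))
  tableauTerm-embed : ∀ x y → (if (E ∖ F) x y then varP x y else (if F x y then oneMinusVarP x y else oneP))
                              ≡ embed x y (termFactor (E x y) (F x y))
  tableauTerm-embed x y =
    sym (trans (Bool.if-float (embed x y) ((E ∖ F) x y))
               (cong (λ p → if (E ∖ F) x y then varP x y else p) (Bool.if-float (embed x y) (F x y))))

-- Faces of the tableau complex

allSetTabs-count : ∀ (G : SetTab nX nY) → ∑ (allSetTabs nX nY) (λ F → ⟦ F ≗ᵇ G ⟧) ≡ + 1
allSetTabs-count {nX} {nY} G = begin
  ∑ (allSetTabs nX nY) (λ F → ⟦ F ≗ᵇ G ⟧)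
    ≡⟨ ∑-cong (allSetTabs nX nY) (λ F _ → sym (∏₂-⟦⟧ λ x y → ⌊ F x y Bool.≟ G x y ⌋)) ⟩
  ∑ (allSetTabs nX nY) (λ F → ∏ λ x → ∏ λ y → agrees x y (F x y))
    ≡⟨ ∑-allFuns nX (allFuns nY bools) (λ x r → ∏ λ y → agrees x y (r y)) ⟩
  (∏ λ x → ∑ (allFuns nY bools) λ r → ∏ λ y → agrees x y (r y))
    ≡⟨ ∏-cong (λ x → ∑-allFuns nY bools (agrees x)) ⟩
  (∏ λ x → ∏ λ y → ∑ bools (agrees x y))
    ≡⟨ ∏-cong (λ x → trans (∏-cong λ y → exactly-one (G x y)) (∏-1 nY)) ⟩
  ∏ {nX} (λ _ → + 1)
    ≡⟨ ∏-1 nX ⟩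
  + 1
  ∎
  where
  bools : List Bool
  bools = true ∷ false ∷ []
  agrees : Fin nX → Fin nY → Bool → ℤ
  agrees x y b = ⟦ ⌊ b Bool.≟ G x y ⌋ ⟧
  exactly-one : ∀ c → ∑ bools (λ b → ⟦ ⌊ b Bool.≟ c ⌋ ⟧) ≡ + 1
  exactly-one true  = refl
  exactly-one false = refl

allSetTabs-complete : ∀ (G : SetTab nX nY) → Any (_≐ G) (allSetTabs nX nY)
allSetTabs-complete {nX} {nY} G =
  Any.map (to T-≗ᵇ) (∑-⟦⟧≡1⇒Any (_≗ᵇ G) (allSetTabs nX nY) (allSetTabs-count G))

module _ {nX nY : ℕ} (Ts : List (Tableau nX nY)) (E : SetTab nX nY) where

  T-admissible : ∀ {F} → T (admissible Ts E F) ⇔ (F ⊆ E × Any (λ f → graph f ⊆ F) Ts)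
  T-admissible {F} = mk⇔
    (λ t → let F⊆ᵇE , some = to (Bool.T-∧ {F ⊆ᵇ E} {containsSome Ts F}) t
           in to T-⊆ᵇ F⊆ᵇE , Any.map (to T-⊆ᵇ) (from any⇔ some))
    (λ (F⊆E , some) → from Bool.T-∧ (from T-⊆ᵇ F⊆E , to any⇔ (Any.map (from T-⊆ᵇ) some)))

  admissible-mono : ∀ {F G} → F ⊆ G → G ⊆ E → T (admissible Ts E F) → T (admissible Ts E G)
  admissible-mono F⊆G G⊆E admF =
    from T-admissible (G⊆E , Any.map (λ f⊆F → ⊆-trans f⊆F F⊆G) (proj₂ (to T-admissible admF)))

  isFace⇔ : ∀ {G} → G ⊆ E → T (isFace Ts E G) ⇔ T (admissible Ts E (E ∖ G))
  isFace⇔ {G} G⊆E = mk⇔ face⇒ ⇒face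
    where
    face⇒ : T (isFace Ts E G) → T (admissible Ts E (E ∖ G))
    face⇒ t =
      let admF , G≐ᵇE∖F = to (Bool.T-∧ {admissible Ts E F}) (proj₂ witness)
          F≐E∖G = ∖-swap (proj₁ (to T-admissible admF)) (to T-≐ᵇ G≐ᵇE∖F)
      in admissible-mono (≐⇒⊆ F≐E∖G) (∖-⊆ E G) admF
      where
      witness : ∃ λ F → T (admissible Ts E F ∧ (G ≐ᵇ (E ∖ F)))
      witness = satisfied (from (any⇔ {xs = allSetTabs nX nY}) t)
      F = proj₁ witness
    ⇒face : T (admissible Ts E (E ∖ G)) → T (isFace Ts E G)
    ⇒face admE∖G = to any⇔ (Any.map witness (allSetTabs-complete (E ∖ G)))
      where
      witness : ∀ {F} → F ≐ (E ∖ G) → T (admissible Ts E F ∧ (G ≐ᵇ (E ∖ F)))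
      witness F≐E∖G = from Bool.T-∧
        ( admissible-mono (≐⇒⊆ (≐-sym F≐E∖G)) (⊆-trans (≐⇒⊆ F≐E∖G) (∖-⊆ E G)) admE∖G
        , from T-≐ᵇ (∖-swap G⊆E F≐E∖G) )

  inSR⇔ : ∀ a → supp a ⊆ E → T (inSR Ts E a) ⇔ (¬ T (admissible Ts E (E ∖ supp a)))
  inSR⇔ a S⊆E = mk⇔ inSR⇒ ⇒inSR
    where
    S = supp a
    inSR⇒ : T (inSR Ts E a) → ¬ T (admissible Ts E (E ∖ S))
    inSR⇒ t admE∖S =
      let G⊆ᵇE , notFace∧G⊆ᵇS = to (Bool.T-∧ {G ⊆ᵇ E}) (proj₂ witness)
          notFace , G⊆ᵇS = to (Bool.T-∧ {not (isFace Ts E G)}) notFace∧G⊆ᵇS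
          admE∖G = admissible-mono (∖-antitone E (to T-⊆ᵇ G⊆ᵇS)) (∖-⊆ E G) admE∖S
      in to T-not notFace (from (isFace⇔ (to T-⊆ᵇ G⊆ᵇE)) admE∖G)
      where
      witness : ∃ λ G → T ((G ⊆ᵇ E) ∧ not (isFace Ts E G) ∧ (G ⊆ᵇ S))
      witness = satisfied (from (any⇔ {xs = allSetTabs nX nY}) t)
      G = proj₁ witness
    ⇒inSR : ¬ T (admissible Ts E (E ∖ S)) → T (inSR Ts E a)
    ⇒inSR ¬admE∖S = to any⇔ (Any.map nonFace (allSetTabs-complete S))
      where
      nonFace : ∀ {G} → G ≐ S → T ((G ⊆ᵇ E) ∧ not (isFace Ts E G) ∧ (G ⊆ᵇ S))
      nonFace G≐S =
        let G⊆E = ⊆-trans (≐⇒⊆ G≐S) S⊆E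
            face⇒admE∖S = admissible-mono (∖-antitone E (≐⇒⊆ (≐-sym G≐S))) (∖-⊆ E S) ∘ to (isFace⇔ G⊆E)
        in from Bool.T-∧ ( from T-⊆ᵇ G⊆E
                         , from Bool.T-∧ (from T-not (¬admE∖S ∘ face⇒admE∖S) , from T-⊆ᵇ (≐⇒⊆ G≐S)) )

  hilbertSR≡ : ∀ a → hilbertSR Ts E a ≡ ⟦ isMonomialOfS E a ∧ admissible Ts E (E ∖ supp a) ⟧
  hilbertSR≡ a with isMonomialOfS E a in monomial
  ... | false = refl
  ... | true  = cong ⟦_⟧ (not-≡ (inSR⇔ a (to T-⊆ᵇ (subst T (sym monomial) tt))))

  complement-inverse : ∀ F S → admissible Ts E F ∧ ((E ∖ F) ≗ᵇ S)
                               ≡ ((S ⊆ᵇ E) ∧ admissible Ts E (E ∖ S)) ∧ (F ≗ᵇ (E ∖ S))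
  complement-inverse F S = T-injective (mk⇔ ⇒ ⇐)
    where
    ⇒ : T (admissible Ts E F ∧ ((E ∖ F) ≗ᵇ S))
      → T (((S ⊆ᵇ E) ∧ admissible Ts E (E ∖ S)) ∧ (F ≗ᵇ (E ∖ S)))
    ⇒ t =
      let admF , E∖F≗ᵇS = to (Bool.T-∧ {admissible Ts E F}) t
          S≐E∖F = ≐-sym (to T-≗ᵇ E∖F≗ᵇS)
          F≐E∖S = ∖-swap (proj₁ (to T-admissible admF)) S≐E∖F
      in from Bool.T-∧ ( from Bool.T-∧ ( from T-⊆ᵇ (⊆-trans (≐⇒⊆ S≐E∖F) (∖-⊆ E F))
                                       , admissible-mono (≐⇒⊆ F≐E∖S) (∖-⊆ E S) admF )
                       , from T-≗ᵇ F≐E∖S )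
    ⇐ : T (((S ⊆ᵇ E) ∧ admissible Ts E (E ∖ S)) ∧ (F ≗ᵇ (E ∖ S)))
      → T (admissible Ts E F ∧ ((E ∖ F) ≗ᵇ S))
    ⇐ t =
      let S⊆ᵇE∧admE∖S , F≗ᵇE∖S = to (Bool.T-∧ {(S ⊆ᵇ E) ∧ admissible Ts E (E ∖ S)}) t
          S⊆ᵇE , admE∖S = to (Bool.T-∧ {S ⊆ᵇ E}) S⊆ᵇE∧admE∖S
          F≐E∖S = to T-≗ᵇ F≗ᵇE∖S
      in from Bool.T-∧ ( admissible-mono (≐⇒⊆ (≐-sym F≐E∖S)) (⊆-trans (≐⇒⊆ F≐E∖S) (∖-⊆ E S)) admE∖S
                       , from T-≗ᵇ (≐-sym (∖-swap (to T-⊆ᵇ S⊆ᵇE) F≐E∖S)) )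

  hilbertSR-∑ : ∀ a → hilbertSR Ts E a
                      ≡ ∑ (filterᵇ (admissible Ts E) (allSetTabs nX nY)) (λ F → Π (supportIndicator (E ∖ F)) a)
  hilbertSR-∑ a = begin
    hilbertSR Ts E a
      ≡⟨ hilbertSR≡ a ⟩
    ⟦ c ⟧
      ≡⟨ sym (ℤ.*-identityʳ ⟦ c ⟧) ⟩
    ⟦ c ⟧ * + 1
      ≡⟨ cong (⟦ c ⟧ *_) (sym (allSetTabs-count (E ∖ supp a))) ⟩
    ⟦ c ⟧ * ∑ Lst (λ F → ⟦ F ≗ᵇ (E ∖ supp a) ⟧)
      ≡⟨ sym (∑-*ˡ Lst ⟦ c ⟧ _) ⟩
    ∑ Lst (λ F → ⟦ c ⟧ * ⟦ F ≗ᵇ (E ∖ supp a) ⟧)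
      ≡⟨ ∑-cong Lst (λ F _ → summand F) ⟩
    ∑ Lst (λ F → ⟦ admissible Ts E F ⟧ * Π (supportIndicator (E ∖ F)) a)
      ≡⟨ sym (∑-filterᵇ (admissible Ts E) Lst _) ⟩
    ∑ (filterᵇ (admissible Ts E) Lst) (λ F → Π (supportIndicator (E ∖ F)) a)
    ∎
    where
    Lst = allSetTabs nX nY
    c = isMonomialOfS E a ∧ admissible Ts E (E ∖ supp a)
    summand : ∀ F → ⟦ c ⟧ * ⟦ F ≗ᵇ (E ∖ supp a) ⟧
                    ≡ ⟦ admissible Ts E F ⟧ * Π (supportIndicator (E ∖ F)) a
    summand F = begin
      ⟦ c ⟧ * ⟦ F ≗ᵇ (E ∖ supp a) ⟧
        ≡⟨ sym (⟦∧⟧ c _) ⟩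
      ⟦ c ∧ (F ≗ᵇ (E ∖ supp a)) ⟧
        ≡⟨ cong ⟦_⟧ (sym (complement-inverse F (supp a))) ⟩
      ⟦ admissible Ts E F ∧ ((E ∖ F) ≗ᵇ supp a) ⟧
        ≡⟨ ⟦∧⟧ (admissible Ts E F) _ ⟩
      ⟦ admissible Ts E F ⟧ * ⟦ (E ∖ F) ≗ᵇ supp a ⟧
        ≡⟨ cong (⟦ admissible Ts E F ⟧ *_) (sym (Π-supportIndicator (E ∖ F) a)) ⟩
      ⟦ admissible Ts E F ⟧ * Π (supportIndicator (E ∖ F)) a
      ∎

  admissible⇒⊆ : ∀ {F} → F ∈ filterᵇ (admissible Ts E) (allSetTabs nX nY) → F ⊆ E
  admissible⇒⊆ F∈ =
    proj₁ (to T-admissible (proj₂ (∈-filter⁻ (T? ∘ admissible Ts E) {xs = allSetTabs nX nY} F∈)))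

proposition4p1 : ∀ {nX nY} (T : List (Tableau nX nY)) (E : SetTab nX nY)
    → (∀ f → f ∈ T → (graph f ⊆ᵇ E) ≡ true)
    → ∀ (a : Exp nX nY) → (hilbertSR T E ⊛ denomE E) a ≡ coeff (kFormula T E) a
proposition4p1 {nX} {nY} Ts E _ a = begin
  (hilbertSR Ts E ⊛ denomE E) a
    ≡⟨ ⊛-cong (hilbertSR-∑ Ts E) (denomE E) a ⟩
  ((λ b → ∑ Adm (λ F → Π (supportIndicator (E ∖ F)) b)) ⊛ denomE E) a
    ≡⟨ ⊛-∑ (λ F → Π (supportIndicator (E ∖ F))) Adm (denomE E) a ⟩
  ∑ Adm (λ F → (Π (supportIndicator (E ∖ F)) ⊛ denomE E) a)
    ≡⟨ ∑-cong Adm (λ F F∈Adm → tableauTerm-action E F (admissible⇒⊆ Ts E F∈Adm) a) ⟩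
  ∑ Adm (λ F → (Π (λ _ _ → unitSeries) ⊛ tableauTerm E F) a)
    ≡⟨ ∑-cong Adm (λ F _ → sym (coeff-as-action (tableauTerm E F) a)) ⟩
  ∑ Adm (λ F → coeff (tableauTerm E F) a)
    ≡⟨ sym (∑-concatMap (tableauTerm E) Adm (λ (c , b) → if b ≡ₑ a then c else + 0)) ⟩
  coeff (kFormula Ts E) a
  ∎
  where
  Adm = filterᵇ (admissible Ts E) (allSetTabs nX nY)
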